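{- For every $\Gamma\cup\{\phi\}\subseteq\mathcal{L}_{\triangledown}$: (1) $\Gamma\vdash_{\mathsf{iM}}\phi$ if and only if $\Gamma^{\Diamond}\vdash_{\mathsf{WM}}\phi^{\Diamond}$; (2) $\Gamma\vdash_{\mathsf{iM}}\phi$ implies $\Gamma^{\Diamond}\vdash_{\mathsf{IM}}\phi^{\Diamond}$; and the implication in (2) is strict, i.e. there exist $\Gamma,\phi$ with $\Gamma^{\Diamond}\vdash_{\mathsf{IM}}\phi^{\Diamond}$ but $\Gamma\not\vdash_{\mathsf{iM}}\phi$.
   Context: $\mathcal{L}_{\triangledown}$: formulas $\phi ::= p_i \mid \bot \mid \phi\wedge\phi \mid \phi\vee\phi \mid \phi\to\phi \mid \triangledown\phi$; $\mathcal{L}_{\Box\Diamond}$: formulas $\phi ::= p_i \mid \bot \mid \phi\wedge\phi \mid \phi\vee\phi \mid \phi\to\phi \mid \Box\phi\mid\Diamond\phi$, over the same countable set of proposition letters; $\neg\phi:=\phi\to\bot$, $\top:=\neg\bot$. For $\phi\in\mathcal{L}_{\triangledown}$, $\phi^{\Diamond}\in\mathcal{L}_{\Box\Diamond}$ replaces every $\triangledown$ by $\Diamond$; $\Gamma^{\Diamond}=\{\psi^{\Diamond}\mid\psi\in\Gamma\}$. Generalised Hilbert calculi: given a set $\mathscr{Ax}$ of formulas (always including all substitution instances of a standard axiomatisation of intuitionistic propositional logic), derivable consecutions $\Gamma\vdash\phi$ are generated by (El) $\Gamma\vdash\phi$ for $\phi\in\Gamma$; (Ax) $\Gamma\vdash\psi$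 for $\psi\in\mathscr{Ax}$; (MP) from $\Gamma\vdash\phi$ and $\Gamma\vdash\phi\to\psi$ infer $\Gamma\vdash\psi$; and for each modality $\heartsuit$ of the language, (Mon$_\heartsuit$) from $\emptyset\vdash\phi\to\psi$ infer $\Gamma\vdash\heartsuit\phi\to\heartsuit\psi$ (any $\Gamma$). $\mathsf{iM}$: language $\mathcal{L}_{\triangledown}$, no extra axioms. $\mathsf{WM}$: language $\mathcal{L}_{\Box\Diamond}$, extra axioms all substitution instances of $(\Box p\wedge\Diamond\neg p)\to\bot$. $\mathsf{IM}$: language $\mathcal{L}_{\Box\Diamond}$, extra axioms all substitution instances of $(\Box p\wedge\Diamond\neg p)\to\bot$ and $(\Box\top\to\Diamond p)\to\Diamond p$. -}

module Defs where

open import Level using (0ℓ)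
open import Data.Nat using (ℕ)
open import Data.Empty using (⊥)
open import Data.Product using (∃; _×_)
open import Relation.Binary.PropositionalEquality using (_≡_)
open import Relation.Unary using (Pred; ∅; _∈_)

infixr 6 _∧'_ _∧_
infixr 5 _∨'_ _∨_
infixr 4 _⇒'_ _⇒_

data Fm▽ : Set where
  var  : ℕ → Fm▽
  ⊥'   : Fm▽
  _∧'_ : Fm▽ → Fm▽ → Fm▽
  _∨'_ : Fm▽ → Fm▽ → Fm▽
  _⇒'_ : Fm▽ → Fm▽ → Fm▽
  ▽    : Fm▽ → Fm▽

data Fm : Set where
  var : ℕ → Fm
  ⊥'  : Fm
  _∧_ : Fm → Fm → Fm
  _∨_ : Fm → Fm → Fm
  _⇒_ : Fm → Fm → Fm
  □   : Fm → Fm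
  ◇   : Fm → Fm

¬▽_ : Fm▽ → Fm▽
¬▽ φ = φ ⇒' ⊥'

∼_ : Fm → Fm
∼ φ = φ ⇒ ⊥'

⊤' : Fm
⊤' = ∼ ⊥'

_◇ᵗ : Fm▽ → Fm
var i ◇ᵗ    = var i
⊥' ◇ᵗ       = ⊥'
(φ ∧' ψ) ◇ᵗ = (φ ◇ᵗ) ∧ (ψ ◇ᵗ)
(φ ∨' ψ) ◇ᵗ = (φ ◇ᵗ) ∨ (ψ ◇ᵗ)
(φ ⇒' ψ) ◇ᵗ = (φ ◇ᵗ) ⇒ (ψ ◇ᵗ)
▽ φ ◇ᵗ      = ◇ (φ ◇ᵗ)

_◇ˢ : Pred Fm▽ 0ℓ → Pred Fm 0ℓ
(Γ ◇ˢ) χ = ∃ λ ψ → ψ ∈ Γ × χ ≡ ψ ◇ᵗ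

data IPC▽ : Pred Fm▽ 0ℓ where
  K   : ∀ φ ψ → IPC▽ (φ ⇒' ψ ⇒' φ)
  S   : ∀ φ ψ χ → IPC▽ ((φ ⇒' ψ ⇒' χ) ⇒' (φ ⇒' ψ) ⇒' φ ⇒' χ)
  ∧E₁ : ∀ φ ψ → IPC▽ (φ ∧' ψ ⇒' φ)
  ∧E₂ : ∀ φ ψ → IPC▽ (φ ∧' ψ ⇒' ψ)
  ∧I  : ∀ φ ψ → IPC▽ (φ ⇒' ψ ⇒' φ ∧' ψ)
  ∨I₁ : ∀ φ ψ → IPC▽ (φ ⇒' φ ∨' ψ)
  ∨I₂ : ∀ φ ψ → IPC▽ (ψ ⇒' φ ∨' ψ)
  ∨E  : ∀ φ ψ χ → IPC▽ ((φ ⇒' χ) ⇒' (ψ ⇒' χ) ⇒' φ ∨' ψ ⇒' χ)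
  ⊥E  : ∀ φ → IPC▽ (⊥' ⇒' φ)

data IPC : Pred Fm 0ℓ where
  K   : ∀ φ ψ → IPC (φ ⇒ ψ ⇒ φ)
  S   : ∀ φ ψ χ → IPC ((φ ⇒ ψ ⇒ χ) ⇒ (φ ⇒ ψ) ⇒ φ ⇒ χ)
  ∧E₁ : ∀ φ ψ → IPC (φ ∧ ψ ⇒ φ)
  ∧E₂ : ∀ φ ψ → IPC (φ ∧ ψ ⇒ ψ)
  ∧I  : ∀ φ ψ → IPC (φ ⇒ ψ ⇒ φ ∧ ψ)
  ∨I₁ : ∀ φ ψ → IPC (φ ⇒ φ ∨ ψ)
  ∨I₂ : ∀ φ ψ → IPC (ψ ⇒ φ ∨ ψ)
  ∨E  : ∀ φ ψ χ → IPC ((φ ⇒ χ) ⇒ (ψ ⇒ χ) ⇒ φ ∨ ψ ⇒ χ)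
  ⊥E  : ∀ φ → IPC (⊥' ⇒ φ)

Ax-iM : Pred Fm▽ 0ℓ
Ax-iM = IPC▽

data Ax-WM : Pred Fm 0ℓ where
  ipc : ∀ {φ} → IPC φ → Ax-WM φ
  wm  : ∀ φ → Ax-WM ((□ φ ∧ ◇ (∼ φ)) ⇒ ⊥')

data Ax-IM : Pred Fm 0ℓ where
  ipc : ∀ {φ} → IPC φ → Ax-IM φ
  wm  : ∀ φ → Ax-IM ((□ φ ∧ ◇ (∼ φ)) ⇒ ⊥')
  im  : ∀ φ → Ax-IM ((□ ⊤' ⇒ ◇ φ) ⇒ ◇ φ)

data Der▽ (Ax : Pred Fm▽ 0ℓ) : Pred Fm▽ 0ℓ → Fm▽ → Set₁ where
  el   : ∀ {Γ φ} → φ ∈ Γ → Der▽ Ax Γ φ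
  ax   : ∀ {Γ φ} → φ ∈ Ax → Der▽ Ax Γ φ
  mp   : ∀ {Γ φ ψ} → Der▽ Ax Γ φ → Der▽ Ax Γ (φ ⇒' ψ) → Der▽ Ax Γ ψ
  mon▽ : ∀ {Γ φ ψ} → Der▽ Ax ∅ (φ ⇒' ψ) → Der▽ Ax Γ (▽ φ ⇒' ▽ ψ)

data Der (Ax : Pred Fm 0ℓ) : Pred Fm 0ℓ → Fm → Set₁ where
  el   : ∀ {Γ φ} → φ ∈ Γ → Der Ax Γ φ
  ax   : ∀ {Γ φ} → φ ∈ Ax → Der Ax Γ φ
  mp   : ∀ {Γ φ ψ} → Der Ax Γ φ → Der Ax Γ (φ ⇒ ψ) → Der Ax Γ ψ
  mon□ : ∀ {Γ φ ψ} → Der Ax ∅ (φ ⇒ ψ) → Der Ax Γ (□ φ ⇒ □ ψ)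
  mon◇ : ∀ {Γ φ ψ} → Der Ax ∅ (φ ⇒ ψ) → Der Ax Γ (◇ φ ⇒ ◇ ψ)

_⊢iM_ : Pred Fm▽ 0ℓ → Fm▽ → Set₁
Γ ⊢iM φ = Der▽ Ax-iM Γ φ

_⊢WM_ : Pred Fm 0ℓ → Fm → Set₁
Γ ⊢WM φ = Der Ax-WM Γ φ

_⊢IM_ : Pred Fm 0ℓ → Fm → Set₁
Γ ⊢IM φ = Der Ax-IM Γ φ

{-# OPTIONS --safe #-}
-- The translation ◇ᵗ sends IPC▽ axioms to IPC axioms and Mon▽ to Mon◇, so it embeds iM into every
-- calculus over L□◇ containing IPC. Conversely, reading □ψ as ⊥ and ◇ as ▽ undoes ◇ᵗ, turns every
-- WM axiom into an instance of ⊥ ∧ χ → ⊥ and Mon□ into ⊥ → ⊥; hence WM is conservative over iM.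
-- IM is not: under □⊤ the WM axiom refutes ◇¬⊤, so ¬¬◇¬⊤ gives □⊤ → ◇¬⊤, and the IM axiom then
-- discharges □⊤. In iM, however, ¬¬▽¬⊤ does not entail ▽¬⊤: in the three-element Gödel chain
-- 0 < ½ < 1 with the monotone operator ▽0 = ½, ▽½ = ▽1 = 1, the premise takes the value ¬¬½ = 1
-- and the conclusion the value ½.
module Submission where

open import Defs
open import Level using (0ℓ)
open import Data.Bool using (if_then_else_)
open import Data.Fin using (Fin; zero; suc)
open import Data.Fin.Properties using (_≟_; _≤?_; all?)
open import Data.Nat using (ℕ)
open import Data.Product using (_×_; Σ; _,_)
open import Function.Bundles using (_⇔_; mk⇔)
open import Relation.Binary.PropositionalEquality using (_≡_; refl; sym; cong; cong₂; subst; module ≡-Reasoning)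
open import Relation.Nullary using (¬_; does)
open import Relation.Nullary.Decidable using (True; toWitness; _→-dec_)
open import Relation.Unary using (Pred; _∈_; _⊆_; ｛_｝)

private
  variable
    Γ : Pred Fm▽ 0ℓ
    Δ : Pred Fm 0ℓ
    φ ψ : Fm▽
    α β γ : Fm

IPC▽⇒IPC-◇ᵗ : IPC▽ φ → IPC (φ ◇ᵗ)
IPC▽⇒IPC-◇ᵗ (K _ _)    = K _ _
IPC▽⇒IPC-◇ᵗ (S _ _ _)  = S _ _ _
IPC▽⇒IPC-◇ᵗ (∧E₁ _ _)  = ∧E₁ _ _
IPC▽⇒IPC-◇ᵗ (∧E₂ _ _)  = ∧E₂ _ _
IPC▽⇒IPC-◇ᵗ (∧I _ _)   = ∧I _ _
IPC▽⇒IPC-◇ᵗ (∨I₁ _ _)  = ∨I₁ _ _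
IPC▽⇒IPC-◇ᵗ (∨I₂ _ _)  = ∨I₂ _ _
IPC▽⇒IPC-◇ᵗ (∨E _ _ _) = ∨E _ _ _
IPC▽⇒IPC-◇ᵗ (⊥E _)     = ⊥E _

module _ {Ax : Pred Fm 0ℓ} (IPC⊆Ax : IPC ⊆ Ax) where

  ◇ᵗ-preserves-⊢ : (∀ {ψ} → ψ ∈ Γ → Der Ax Δ (ψ ◇ᵗ)) → Γ ⊢iM φ → Der Ax Δ (φ ◇ᵗ)
  ◇ᵗ-preserves-⊢ hyp (el ψ∈Γ)  = hyp ψ∈Γ
  ◇ᵗ-preserves-⊢ hyp (ax φ∈Ax) = ax (IPC⊆Ax (IPC▽⇒IPC-◇ᵗ φ∈Ax))
  ◇ᵗ-preserves-⊢ hyp (mp d e)  = mp (◇ᵗ-preserves-⊢ hyp d) (◇ᵗ-preserves-⊢ hyp e)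
  ◇ᵗ-preserves-⊢ hyp (mon▽ d)  = mon◇ (◇ᵗ-preserves-⊢ (λ ()) d)

  ⊢iM⇒⊢-◇ᵗ : Γ ⊢iM φ → Der Ax (Γ ◇ˢ) (φ ◇ᵗ)
  ⊢iM⇒⊢-◇ᵗ = ◇ᵗ-preserves-⊢ (λ {ψ} ψ∈Γ → el (ψ , ψ∈Γ , refl))

  ⇒-postcompose : Der Ax Δ (β ⇒ γ) → Der Ax Δ ((α ⇒ β) ⇒ (α ⇒ γ))
  ⇒-postcompose β⇒γ = mp (mp β⇒γ (ax (IPC⊆Ax (K _ _)))) (ax (IPC⊆Ax (S _ _ _)))

  ⇒-trans : Der Ax Δ (α ⇒ β) → Der Ax Δ (β ⇒ γ) → Der Ax Δ (α ⇒ γ)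
  ⇒-trans α⇒β β⇒γ = mp α⇒β (⇒-postcompose β⇒γ)

  ∧-curry : Der Ax Δ (α ∧ β ⇒ γ) → Der Ax Δ (α ⇒ β ⇒ γ)
  ∧-curry α∧β⇒γ = ⇒-trans (ax (IPC⊆Ax (∧I _ _))) (⇒-postcompose α∧β⇒γ)

_▽ᵗ : Fm → Fm▽
var i ▽ᵗ   = var i
⊥' ▽ᵗ      = ⊥'
(α ∧ β) ▽ᵗ = (α ▽ᵗ) ∧' (β ▽ᵗ)
(α ∨ β) ▽ᵗ = (α ▽ᵗ) ∨' (β ▽ᵗ)
(α ⇒ β) ▽ᵗ = (α ▽ᵗ) ⇒' (β ▽ᵗ)
□ α ▽ᵗ     = ⊥'
◇ α ▽ᵗ     = ▽ (α ▽ᵗ)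

▽ᵗ-◇ᵗ : ∀ φ → (φ ◇ᵗ) ▽ᵗ ≡ φ
▽ᵗ-◇ᵗ (var i)  = refl
▽ᵗ-◇ᵗ ⊥'       = refl
▽ᵗ-◇ᵗ (φ ∧' ψ) = cong₂ _∧'_ (▽ᵗ-◇ᵗ φ) (▽ᵗ-◇ᵗ ψ)
▽ᵗ-◇ᵗ (φ ∨' ψ) = cong₂ _∨'_ (▽ᵗ-◇ᵗ φ) (▽ᵗ-◇ᵗ ψ)
▽ᵗ-◇ᵗ (φ ⇒' ψ) = cong₂ _⇒'_ (▽ᵗ-◇ᵗ φ) (▽ᵗ-◇ᵗ ψ)
▽ᵗ-◇ᵗ (▽ φ)    = cong ▽ (▽ᵗ-◇ᵗ φ)

Ax-WM⇒IPC▽-▽ᵗ : Ax-WM α → IPC▽ (α ▽ᵗ)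
Ax-WM⇒IPC▽-▽ᵗ (ipc (K _ _))    = K _ _
Ax-WM⇒IPC▽-▽ᵗ (ipc (S _ _ _))  = S _ _ _
Ax-WM⇒IPC▽-▽ᵗ (ipc (∧E₁ _ _))  = ∧E₁ _ _
Ax-WM⇒IPC▽-▽ᵗ (ipc (∧E₂ _ _))  = ∧E₂ _ _
Ax-WM⇒IPC▽-▽ᵗ (ipc (∧I _ _))   = ∧I _ _
Ax-WM⇒IPC▽-▽ᵗ (ipc (∨I₁ _ _))  = ∨I₁ _ _
Ax-WM⇒IPC▽-▽ᵗ (ipc (∨I₂ _ _))  = ∨I₂ _ _
Ax-WM⇒IPC▽-▽ᵗ (ipc (∨E _ _ _)) = ∨E _ _ _
Ax-WM⇒IPC▽-▽ᵗ (ipc (⊥E _))     = ⊥E _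
Ax-WM⇒IPC▽-▽ᵗ (wm _)           = ∧E₁ ⊥' _

▽ᵗ-preserves-⊢ : (∀ {α} → α ∈ Δ → Γ ⊢iM (α ▽ᵗ)) → Δ ⊢WM β → Γ ⊢iM (β ▽ᵗ)
▽ᵗ-preserves-⊢ hyp (el α∈Δ)  = hyp α∈Δ
▽ᵗ-preserves-⊢ hyp (ax α∈Ax) = ax (Ax-WM⇒IPC▽-▽ᵗ α∈Ax)
▽ᵗ-preserves-⊢ hyp (mp d e)  = mp (▽ᵗ-preserves-⊢ hyp d) (▽ᵗ-preserves-⊢ hyp e)
▽ᵗ-preserves-⊢ hyp (mon□ _)  = ax (⊥E ⊥')
▽ᵗ-preserves-⊢ hyp (mon◇ d)  = mon▽ (▽ᵗ-preserves-⊢ (λ ()) d)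

⊢WM-◇ᵗ⇒⊢iM : (Γ ◇ˢ) ⊢WM (φ ◇ᵗ) → Γ ⊢iM φ
⊢WM-◇ᵗ⇒⊢iM {Γ} {φ} d = subst (Γ ⊢iM_) (▽ᵗ-◇ᵗ φ) (▽ᵗ-preserves-⊢ ◇ˢ-hyp d)
  where
  ◇ˢ-hyp : ∀ {α} → α ∈ (Γ ◇ˢ) → Γ ⊢iM (α ▽ᵗ)
  ◇ˢ-hyp (ψ , ψ∈Γ , refl) = subst (Γ ⊢iM_) (sym (▽ᵗ-◇ᵗ ψ)) (el ψ∈Γ)

¬¬◇¬⊤⇒◇¬⊤-IM : Δ ⊢IM (∼ ∼ ◇ (∼ ⊤')) → Δ ⊢IM ◇ (∼ ⊤')
¬¬◇¬⊤⇒◇¬⊤-IM {Δ} ¬¬◇¬⊤ = mp □⊤⇒◇¬⊤ (ax (im (∼ ⊤')))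
  where
  □⊤⇒◇¬⊤ : Δ ⊢IM (□ ⊤' ⇒ ◇ (∼ ⊤'))
  □⊤⇒◇¬⊤ = ⇒-trans ipc (⇒-trans ipc (∧-curry ipc (ax (wm ⊤'))) ¬¬◇¬⊤) (ax (ipc (⊥E _)))

V : Set
V = Fin 3

pattern 0ᵥ = zero
pattern ½  = suc zero
pattern 1ᵥ = suc (suc zero)

_⊓_ _⊔_ _⇨_ : V → V → V
a ⊓ b = if does (a ≤? b) then a else b
a ⊔ b = if does (a ≤? b) then b else a
a ⇨ b = if does (a ≤? b) then 1ᵥ else b

▽ᵥ : V → V
▽ᵥ 0ᵥ = ½
▽ᵥ _  = 1ᵥ

valid² : (f : V → V → V) {_ : True (all? λ a → all? λ b → f a b ≟ 1ᵥ)} → ∀ a b → f a b ≡ 1ᵥ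
valid² f {t} = toWitness t

valid³ : (f : V → V → V → V) {_ : True (all? λ a → all? λ b → all? λ c → f a b c ≟ 1ᵥ)} →
         ∀ a b c → f a b c ≡ 1ᵥ
valid³ f {t} = toWitness t

1ᵥ⇨ : ∀ a → 1ᵥ ⇨ a ≡ a
1ᵥ⇨ = toWitness {a? = all? λ a → 1ᵥ ⇨ a ≟ a} _

▽ᵥ-mono : ∀ a b → a ⇨ b ≡ 1ᵥ → ▽ᵥ a ⇨ ▽ᵥ b ≡ 1ᵥ
▽ᵥ-mono = toWitness {a? = all? λ a → all? λ b → (a ⇨ b ≟ 1ᵥ) →-dec (▽ᵥ a ⇨ ▽ᵥ b ≟ 1ᵥ)} _

module _ (ρ : ℕ → V) where

  ⟦_⟧ : Fm▽ → V
  ⟦ var i ⟧  = ρ i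
  ⟦ ⊥' ⟧     = 0ᵥ
  ⟦ φ ∧' ψ ⟧ = ⟦ φ ⟧ ⊓ ⟦ ψ ⟧
  ⟦ φ ∨' ψ ⟧ = ⟦ φ ⟧ ⊔ ⟦ ψ ⟧
  ⟦ φ ⇒' ψ ⟧ = ⟦ φ ⟧ ⇨ ⟦ ψ ⟧
  ⟦ ▽ φ ⟧    = ▽ᵥ ⟦ φ ⟧

  IPC▽-valid : IPC▽ φ → ⟦ φ ⟧ ≡ 1ᵥ
  IPC▽-valid (K φ ψ)    = valid² (λ a b → a ⇨ (b ⇨ a)) ⟦ φ ⟧ ⟦ ψ ⟧
  IPC▽-valid (S φ ψ χ)  = valid³ (λ a b c → (a ⇨ (b ⇨ c)) ⇨ ((a ⇨ b) ⇨ (a ⇨ c))) ⟦ φ ⟧ ⟦ ψ ⟧ ⟦ χ ⟧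
  IPC▽-valid (∧E₁ φ ψ)  = valid² (λ a b → (a ⊓ b) ⇨ a) ⟦ φ ⟧ ⟦ ψ ⟧
  IPC▽-valid (∧E₂ φ ψ)  = valid² (λ a b → (a ⊓ b) ⇨ b) ⟦ φ ⟧ ⟦ ψ ⟧
  IPC▽-valid (∧I φ ψ)   = valid² (λ a b → a ⇨ (b ⇨ (a ⊓ b))) ⟦ φ ⟧ ⟦ ψ ⟧
  IPC▽-valid (∨I₁ φ ψ)  = valid² (λ a b → a ⇨ (a ⊔ b)) ⟦ φ ⟧ ⟦ ψ ⟧
  IPC▽-valid (∨I₂ φ ψ)  = valid² (λ a b → b ⇨ (a ⊔ b)) ⟦ φ ⟧ ⟦ ψ ⟧
  IPC▽-valid (∨E φ ψ χ) = valid³ (λ a b c → (a ⇨ c) ⇨ ((b ⇨ c) ⇨ ((a ⊔ b) ⇨ c))) ⟦ φ ⟧ ⟦ ψ ⟧ ⟦ χ ⟧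
  IPC▽-valid (⊥E _)     = refl

  iM-sound : (∀ {ψ} → ψ ∈ Γ → ⟦ ψ ⟧ ≡ 1ᵥ) → Γ ⊢iM φ → ⟦ φ ⟧ ≡ 1ᵥ
  iM-sound hyp (el φ∈Γ)  = hyp φ∈Γ
  iM-sound hyp (ax φ∈Ax) = IPC▽-valid φ∈Ax
  iM-sound hyp (mp {φ = φ} {ψ} d e) = begin
    ⟦ ψ ⟧         ≡⟨ sym (1ᵥ⇨ ⟦ ψ ⟧) ⟩
    1ᵥ ⇨ ⟦ ψ ⟧    ≡⟨ cong (_⇨ ⟦ ψ ⟧) (sym (iM-sound hyp d)) ⟩
    ⟦ φ ⟧ ⇨ ⟦ ψ ⟧ ≡⟨ iM-sound hyp e ⟩
    1ᵥ            ∎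
    where open ≡-Reasoning
  iM-sound hyp (mon▽ {φ = φ} {ψ} d) = ▽ᵥ-mono ⟦ φ ⟧ ⟦ ψ ⟧ (iM-sound (λ ()) d)

¬▽⊤ : Fm▽
¬▽⊤ = ¬▽ (¬▽ ⊥')

¬¬▽¬⊤⊬▽¬⊤-iM : ¬ (｛ ¬▽ (¬▽ (▽ ¬▽⊤)) ｝ ⊢iM ▽ ¬▽⊤)
¬¬▽¬⊤⊬▽¬⊤-iM d with iM-sound (λ _ → 0ᵥ) (λ { refl → refl }) d
... | ()

theorem4p11 : ((Γ : Pred Fm▽ 0ℓ) (φ : Fm▽) → (Γ ⊢iM φ) ⇔ ((Γ ◇ˢ) ⊢WM (φ ◇ᵗ)))
    × ((Γ : Pred Fm▽ 0ℓ) (φ : Fm▽) → Γ ⊢iM φ → (Γ ◇ˢ) ⊢IM (φ ◇ᵗ))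
    × Σ (Pred Fm▽ 0ℓ) (λ Γ → Σ Fm▽ (λ φ → ((Γ ◇ˢ) ⊢IM (φ ◇ᵗ)) × ¬ (Γ ⊢iM φ)))
theorem4p11 =
    (λ _ _ → mk⇔ (⊢iM⇒⊢-◇ᵗ ipc) ⊢WM-◇ᵗ⇒⊢iM)
  , (λ _ _ → ⊢iM⇒⊢-◇ᵗ ipc)
  , ｛ ¬▽ (¬▽ (▽ ¬▽⊤)) ｝ , ▽ ¬▽⊤
  , ¬¬◇¬⊤⇒◇¬⊤-IM (el (_ , refl , refl)) , ¬¬▽¬⊤⊬▽¬⊤-iM
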